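{- Let $t, u_1, \dots, u_k$ ($k \ge 0$) be $\lambda$-terms such that $(t\ u_1\ \dots\ u_k)$ is typable in system $\mathcal D$, and let $x$ be a variable not free in $u_1, \dots, u_k$. If $(t\ u_1\ \dots\ u_k)$ is strongly normalizing, then $(\lambda x.t\ x\ u_1\ \dots\ u_k)$ is strongly normalizing.
   Context: $\lambda$-terms: $\mathcal M ::= x \mid \lambda x.\mathcal M \mid (\mathcal M\ \mathcal M)$, application associating to the left, and $(\lambda x.t\ x\ u_1 \dots u_k)$ denotes the abstraction $\lambda x.t$ applied successively to $x, u_1, \dots, u_k$; terms up to renaming of bound variables. Reduction $\triangleright$ is the union (on any subterm) of: $\beta$: $(\lambda x.M\ N) \triangleright M[x:=N]$; $\delta$: $(\lambda y.\lambda x.M\ N) \triangleright \lambda x.(\lambda y.M\ N)$ ($x$ not free in $N$); $\gamma$: $(\lambda x.M\ N\ P) \triangleright (\lambda x.(M\ P)\ N)$ ($x$ not free in $P$); $assoc$: $(M\ (\lambda x.N\ P)) \triangleright (\lambda x.(M\ N)\ P)$ ($x$ not free in $M$). "Strongly normalizing" means every $\triangleright$-reduction sequence is finite. System $\mathcal D$: with a set $\mathcal A$ of atomic types, simple types $\mathcal S ::= \mathcal A \mid \mathcal T \to \mathcal S$ and types $\mathcal T ::= \mathcal S \mid \mathcal S \wedge \mathcal T$; contexts $\Gamma$ are sets of declarations $x:A$; rules: $\Gamma, x:A \vdash x:A$; from $\Gamma \vdash M : A\to B$ and $\Gamma \vdash N:A$ infer $\Gamma \vdash (M\ N):B$; from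 $\Gamma, x:A \vdash M:B$ infer $\Gamma \vdash \lambda x.M : A \to B$; from $\Gamma \vdash M : A\wedge B$ infer $\Gamma \vdash M:A$ and $\Gamma \vdash M : B$; from $\Gamma \vdash M:A$ and $\Gamma \vdash M:B$ infer $\Gamma \vdash M : A \wedge B$. -}

module Defs where

open import Data.Nat using (ℕ; zero; suc; _≟_)
open import Data.List using (List; []; _∷_; foldl)
open import Data.Maybe using (Maybe; just; nothing)
open import Data.Product using (Σ; ∃; _×_; _,_)
open import Relation.Nullary using (yes; no)
open import Relation.Binary.PropositionalEquality using (_≡_)
open import Induction.WellFounded using (Acc)

-- λ-terms, de Bruijn indices (terms up to α-renaming).
-- Free variables are the indices that escape all binders; the named
-- variable x corresponds to the free index x.

data Term : Set where
  var : ℕ → Term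
  lam : Term → Term
  app : Term → Term → Term

apps : Term → List Term → Term
apps t us = foldl app t us

ext : (ℕ → ℕ) → ℕ → ℕ
ext ρ zero    = zero
ext ρ (suc i) = suc (ρ i)

rename : (ℕ → ℕ) → Term → Term
rename ρ (var i)   = var (ρ i)
rename ρ (lam M)   = lam (rename (ext ρ) M)
rename ρ (app M N) = app (rename ρ M) (rename ρ N)

shift : Term → Term
shift = rename suc

swap01 : ℕ → ℕ
swap01 zero          = suc zero
swap01 (suc zero)    = zero
swap01 (suc (suc n)) = suc (suc n)

exts : (ℕ → Term) → ℕ → Term
exts σ zero    = var zero
exts σ (suc i) = shift (σ i)

sub : (ℕ → Term) → Term → Term
sub σ (var i)   = σ i
sub σ (lam M)   = lam (sub (exts σ) M)
sub σ (app M N) = app (sub σ M) (sub σ N)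

_[_] : Term → Term → Term
M [ N ] = sub σ M
  where
  σ : ℕ → Term
  σ zero    = N
  σ (suc i) = var i

-- binding the (free) variable x:  λx.t  =  lam (close x t)
closeRen : ℕ → ℕ → ℕ
closeRen x y with y ≟ x
... | yes _ = zero
... | no  _ = suc y

close : ℕ → Term → Term
close x t = rename (closeRen x) t

ƛ : ℕ → Term → Term
ƛ x t = lam (close x t)

data Free : ℕ → Term → Set where
  fvar : ∀ {x} → Free x (var x)
  flam : ∀ {x M} → Free (suc x) M → Free x (lam M)
  fapl : ∀ {x M N} → Free x M → Free x (app M N)
  fapr : ∀ {x M N} → Free x N → Free x (app M N)

-- Reduction ▷ : β, δ, γ, assoc, closed under all term contexts.
-- (The freshness side conditions of δ, γ, assoc are automatic with
--  de Bruijn indices, via shift.)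

infix 4 _▷_
data _▷_ : Term → Term → Set where
  β     : ∀ {M N} → app (lam M) N ▷ M [ N ]
  δ     : ∀ {M N} → app (lam (lam M)) N ▷ lam (app (lam (rename swap01 M)) (shift N))
  γ     : ∀ {M N P} → app (app (lam M) N) P ▷ app (lam (app M (shift P))) N
  assoc : ∀ {M N P} → app M (app (lam N) P) ▷ app (lam (app (shift M) N)) P
  ξlam  : ∀ {M M'} → M ▷ M' → lam M ▷ lam M'
  ξappl : ∀ {M M' N} → M ▷ M' → app M N ▷ app M' N
  ξappr : ∀ {M N N'} → N ▷ N' → app M N ▷ app M N'

-- strongly normalizing: accessible for ▷ (no infinite reduction sequence)
SN : Term → Set
SN = Acc (λ N M → M ▷ N)

module SystemD (𝒜 : Set) where

  mutual
    data SType : Set where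
      atom : 𝒜 → SType
      _⇒_  : Type → SType → SType

    data Type : Set where
      ⌊_⌋ : SType → Type
      _∧_ : SType → Type → Type

  Ctx : Set
  Ctx = ℕ → Maybe Type

  _,,_ : Ctx → Type → Ctx
  (Γ ,, A) zero    = just A
  (Γ ,, A) (suc i) = Γ i

  infix 3 _⊢_∶_
  data _⊢_∶_ : Ctx → Term → Type → Set where
    ax   : ∀ {Γ x A} → Γ x ≡ just A → Γ ⊢ var x ∶ A
    →E   : ∀ {Γ M N A B} → Γ ⊢ M ∶ ⌊ A ⇒ B ⌋ → Γ ⊢ N ∶ A → Γ ⊢ app M N ∶ ⌊ B ⌋
    →I   : ∀ {Γ M A B} → (Γ ,, A) ⊢ M ∶ ⌊ B ⌋ → Γ ⊢ lam M ∶ ⌊ A ⇒ B ⌋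
    ∧E₁  : ∀ {Γ M A B} → Γ ⊢ M ∶ A ∧ B → Γ ⊢ M ∶ ⌊ A ⌋
    ∧E₂  : ∀ {Γ M A B} → Γ ⊢ M ∶ A ∧ B → Γ ⊢ M ∶ B
    ∧I   : ∀ {Γ M A B} → Γ ⊢ M ∶ ⌊ A ⌋ → Γ ⊢ M ∶ B → Γ ⊢ M ∶ A ∧ B

  Typable : Term → Set
  Typable M = Σ Ctx λ Γ → Σ Type λ A → Γ ⊢ M ∶ A

module Submission where

-- Write the named redex (λx.t) x as the de Bruijn term
-- (λ.t') (var x) with t'[0 := x] = t.  We prove the stronger, type-free
-- statement: if N is strongly normalizing and M is obtained from N by
-- re-introducing "identity redexes" (λ.A) (var i) whose argument is a free
-- variable (the relation  Erases d M N  below, d = number of binders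
-- passed), then M is strongly normalizing.

open import Defs
open import Data.Nat using (ℕ; zero; suc; _+_; _*_; _≤_; _<_; z≤n; s≤s; _≟_)
open import Data.Nat.Properties
open import Data.Nat.Induction using (<-wellFounded)
open import Data.Nat.Tactic.RingSolver using (solve-∀)
open import Data.List using (List; []; _∷_)
open import Data.List.Membership.Propositional using (_∈_)
open import Data.Product using (Σ; _,_; _×_)
open import Data.Product.Relation.Binary.Lex.Strict using (×-Lex; ×-wellFounded)
open import Data.Sum using (inj₁; inj₂)
open import Function using (_∘_)
open import Induction.WellFounded using (Acc; acc)
open import Relation.Nullary using (¬_; yes; no)
open import Relation.Binary.PropositionalEquality hiding ([_])
open ≡-Reasoning

-- 1. Renaming and substitution

ext-cong : ∀ {ρ ρ' : ℕ → ℕ} → (∀ j → ρ j ≡ ρ' j) → ∀ j → ext ρ j ≡ ext ρ' j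
ext-cong h zero    = refl
ext-cong h (suc j) = cong suc (h j)

rename-cong : ∀ {ρ ρ' : ℕ → ℕ} → (∀ j → ρ j ≡ ρ' j) → ∀ M → rename ρ M ≡ rename ρ' M
rename-cong h (var i)   = cong var (h i)
rename-cong h (lam M)   = cong lam (rename-cong (ext-cong h) M)
rename-cong h (app M N) = cong₂ app (rename-cong h M) (rename-cong h N)

exts-cong : ∀ {σ τ : ℕ → Term} → (∀ j → σ j ≡ τ j) → ∀ j → exts σ j ≡ exts τ j
exts-cong h zero    = refl
exts-cong h (suc j) = cong shift (h j)

sub-cong : ∀ {σ τ : ℕ → Term} → (∀ j → σ j ≡ τ j) → ∀ M → sub σ M ≡ sub τ M
sub-cong h (var i)   = h i
sub-cong h (lam M)   = cong lam (sub-cong (exts-cong h) M)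
sub-cong h (app M N) = cong₂ app (sub-cong h M) (sub-cong h N)

rename-rename : ∀ (ρ ρ' : ℕ → ℕ) M → rename ρ (rename ρ' M) ≡ rename (ρ ∘ ρ') M
rename-rename ρ ρ' (var i)   = refl
rename-rename ρ ρ' (lam M)   =
  cong lam (trans (rename-rename (ext ρ) (ext ρ') M) (rename-cong ext-∘ M))
  where
  ext-∘ : ∀ j → ext ρ (ext ρ' j) ≡ ext (ρ ∘ ρ') j
  ext-∘ zero    = refl
  ext-∘ (suc j) = refl
rename-rename ρ ρ' (app M N) = cong₂ app (rename-rename ρ ρ' M) (rename-rename ρ ρ' N)

sub-rename : ∀ (σ : ℕ → Term) (ρ : ℕ → ℕ) M → sub σ (rename ρ M) ≡ sub (σ ∘ ρ) M
sub-rename σ ρ (var i)   = refl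
sub-rename σ ρ (lam M)   =
  cong lam (trans (sub-rename (exts σ) (ext ρ) M) (sub-cong exts-ext M))
  where
  exts-ext : ∀ j → exts σ (ext ρ j) ≡ exts (σ ∘ ρ) j
  exts-ext zero    = refl
  exts-ext (suc j) = refl
sub-rename σ ρ (app M N) = cong₂ app (sub-rename σ ρ M) (sub-rename σ ρ N)

rename-sub : ∀ (ρ : ℕ → ℕ) (σ : ℕ → Term) M → rename ρ (sub σ M) ≡ sub (rename ρ ∘ σ) M
rename-sub ρ σ (var i)   = refl
rename-sub ρ σ (lam M)   =
  cong lam (trans (rename-sub (ext ρ) (exts σ) M) (sub-cong ext-exts M))
  where
  ext-exts : ∀ j → rename (ext ρ) (exts σ j) ≡ exts (rename ρ ∘ σ) j
  ext-exts zero    = refl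
  ext-exts (suc j) = trans (rename-rename (ext ρ) suc (σ j)) (sym (rename-rename suc ρ (σ j)))
rename-sub ρ σ (app M N) = cong₂ app (rename-sub ρ σ M) (rename-sub ρ σ N)

sub-exts-shift : ∀ (τ : ℕ → Term) P → sub (exts τ) (shift P) ≡ shift (sub τ P)
sub-exts-shift τ P = trans (sub-rename (exts τ) suc P) (sym (rename-sub suc τ P))

sub-sub : ∀ (τ σ : ℕ → Term) M → sub τ (sub σ M) ≡ sub (sub τ ∘ σ) M
sub-sub τ σ (var i)   = refl
sub-sub τ σ (lam M)   =
  cong lam (trans (sub-sub (exts τ) (exts σ) M) (sub-cong exts-exts M))
  where
  exts-exts : ∀ j → sub (exts τ) (exts σ j) ≡ exts (sub τ ∘ σ) j
  exts-exts zero    = refl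
  exts-exts (suc j) = sub-exts-shift τ (σ j)
sub-sub τ σ (app M N) = cong₂ app (sub-sub τ σ M) (sub-sub τ σ N)

sub-var : ∀ M → sub var M ≡ M
sub-var (var i)   = refl
sub-var (lam M)   = cong lam (trans (sub-cong exts-var M) (sub-var M))
  where
  exts-var : ∀ j → exts var j ≡ var j
  exts-var zero    = refl
  exts-var (suc j) = refl
sub-var (app M N) = cong₂ app (sub-var M) (sub-var N)

rename-as-sub : ∀ (ρ : ℕ → ℕ) M → rename ρ M ≡ sub (var ∘ ρ) M
rename-as-sub ρ (var i)   = refl
rename-as-sub ρ (lam M)   =
  cong lam (trans (rename-as-sub (ext ρ) M) (sub-cong ext-var M))
  where
  ext-var : ∀ j → var (ext ρ j) ≡ exts (var ∘ ρ) j
  ext-var zero    = refl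
  ext-var (suc j) = refl
rename-as-sub ρ (app M N) = cong₂ app (rename-as-sub ρ M) (rename-as-sub ρ N)

-- The substitution [0 := N] as a named function, so that it can be
-- composed with other substitutions.
single : Term → ℕ → Term
single N zero    = N
single N (suc j) = var j

[]-as-sub : ∀ M N → M [ N ] ≡ sub (single N) M
[]-as-sub M N = sub-cong agree M
  where
  agree : ∀ j → _ ≡ single N j
  agree zero    = refl
  agree (suc j) = refl

sub-[] : ∀ (τ : ℕ → Term) B P → sub τ (B [ P ]) ≡ (sub (exts τ) B) [ sub τ P ]
sub-[] τ B P = begin
  sub τ (B [ P ])                           ≡⟨ cong (sub τ) ([]-as-sub B P) ⟩
  sub τ (sub (single P) B)                  ≡⟨ sub-sub τ (single P) B ⟩
  sub (sub τ ∘ single P) B                  ≡⟨ sub-cong agree B ⟩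
  sub (sub (single (sub τ P)) ∘ exts τ) B   ≡⟨ sub-sub (single (sub τ P)) (exts τ) B ⟨
  sub (single (sub τ P)) (sub (exts τ) B)   ≡⟨ []-as-sub (sub (exts τ) B) (sub τ P) ⟨
  (sub (exts τ) B) [ sub τ P ]              ∎
  where
  agree : ∀ j → sub τ (single P j) ≡ sub (single (sub τ P)) (exts τ j)
  agree zero    = refl
  agree (suc j) = sym (trans (sub-rename (single (sub τ P)) suc (τ j)) (sub-var (τ j)))

shift-[] : ∀ X N → (shift X) [ N ] ≡ X
shift-[] X N = trans ([]-as-sub (shift X) N) (trans (sub-rename (single N) suc X) (sub-var X))

rename-[] : ∀ (ρ : ℕ → ℕ) B i → rename ρ (B [ var i ]) ≡ (rename (ext ρ) B) [ var (ρ i) ]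
rename-[] ρ B i = begin
  rename ρ (B [ var i ])                  ≡⟨ rename-as-sub ρ (B [ var i ]) ⟩
  sub (var ∘ ρ) (B [ var i ])             ≡⟨ sub-[] (var ∘ ρ) B (var i) ⟩
  (sub (exts (var ∘ ρ)) B) [ var (ρ i) ]  ≡⟨ cong (_[ var (ρ i) ]) (sub-cong ext-var B) ⟨
  (sub (var ∘ ext ρ) B) [ var (ρ i) ]     ≡⟨ cong (_[ var (ρ i) ]) (rename-as-sub (ext ρ) B) ⟨
  (rename (ext ρ) B) [ var (ρ i) ]        ∎
  where
  ext-var : ∀ j → var (ext ρ j) ≡ exts (var ∘ ρ) j
  ext-var zero    = refl
  ext-var (suc j) = refl

-- Instantiating a freshly bound variable by itself undoes the binding:
-- (λx.t) x  is the identity redex  (λ. close x t) (var x)  contracting to t.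
close-[] : ∀ x t → (close x t) [ var x ] ≡ t
close-[] x t = begin
  (close x t) [ var x ]                     ≡⟨ []-as-sub (close x t) (var x) ⟩
  sub (single (var x)) (close x t)          ≡⟨ sub-rename (single (var x)) (closeRen x) t ⟩
  sub (single (var x) ∘ closeRen x) t       ≡⟨ sub-cong reopen t ⟩
  sub var t                                 ≡⟨ sub-var t ⟩
  t                                         ∎
  where
  reopen : ∀ y → single (var x) (closeRen x y) ≡ var y
  reopen y with y ≟ x
  ... | yes y≡x = cong var (sym y≡x)
  ... | no  _   = refl

swap-exts² : ∀ (σ : ℕ → Term) M →
  rename swap01 (sub (exts (exts σ)) M) ≡ sub (exts (exts σ)) (rename swap01 M)
swap-exts² σ M = trans (rename-sub swap01 (exts (exts σ)) M)
  (trans (sub-cong swap-agree M) (sym (sub-rename (exts (exts σ)) swap01 M)))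
  where
  swap-agree : ∀ j → rename swap01 (exts (exts σ) j) ≡ exts (exts σ) (swap01 j)
  swap-agree zero          = refl
  swap-agree (suc zero)    = refl
  swap-agree (suc (suc k)) = trans (rename-rename swap01 suc (shift (σ k)))
    (trans (rename-rename (swap01 ∘ suc) suc (σ k)) (sym (rename-rename suc suc (σ k))))

▷-sub : ∀ (σ : ℕ → Term) {M M'} → M ▷ M' → sub σ M ▷ sub σ M'
▷-sub σ (β {M} {N}) = subst (sub σ (app (lam M) N) ▷_) (sym (sub-[] σ M N)) β
▷-sub σ (δ {M} {N}) = subst (sub σ (app (lam (lam M)) N) ▷_)
  (cong lam (cong₂ app (cong lam (swap-exts² σ M)) (sym (sub-exts-shift σ N)))) δ
▷-sub σ (γ {M} {N} {P}) = subst (sub σ (app (app (lam M) N) P) ▷_)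
  (cong (λ P' → app (lam (app (sub (exts σ) M) P')) (sub σ N)) (sym (sub-exts-shift σ P))) γ
▷-sub σ (assoc {M} {N} {P}) = subst (sub σ (app M (app (lam N) P)) ▷_)
  (cong (λ M' → app (lam (app M' (sub (exts σ) N))) (sub σ P)) (sym (sub-exts-shift σ M))) assoc
▷-sub σ (ξlam s)  = ξlam (▷-sub (exts σ) s)
▷-sub σ (ξappl s) = ξappl (▷-sub σ s)
▷-sub σ (ξappr s) = ξappr (▷-sub σ s)

▷-[] : ∀ {B B'} N → B ▷ B' → B [ N ] ▷ B' [ N ]
▷-[] {B} {B'} N s =
  subst₂ _▷_ (sym ([]-as-sub B N)) (sym ([]-as-sub B' N)) (▷-sub (single N) s)

-- 2. Erasure of identity redexes

-- Erases d M N:  N is obtained from M by contracting some marked redexes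
-- (λ.A) (var i) whose argument i is free, i.e. not bound inside the
-- enclosing term (d counts the binders passed so far, so i ≥ d).
data Erases : ℕ → Term → Term → Set where
  evar  : ∀ {d i} → Erases d (var i) (var i)
  elam  : ∀ {d M N} → Erases (suc d) M N → Erases d (lam M) (lam N)
  eapp  : ∀ {d M N P Q} → Erases d M N → Erases d P Q → Erases d (app M P) (app N Q)
  emark : ∀ {d A B i N} → d ≤ i → Erases (suc d) A B → N ≡ B [ var i ] →
          Erases d (app (lam A) (var i)) N

Erases-refl : ∀ d M → Erases d M M
Erases-refl d (var i)   = evar
Erases-refl d (lam M)   = elam (Erases-refl (suc d) M)
Erases-refl d (app M N) = eapp (Erases-refl d M) (Erases-refl d N)

Erases-apps : ∀ {d H T} → Erases d H T → ∀ us → Erases d (apps H us) (apps T us)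
Erases-apps D []       = D
Erases-apps D (u ∷ us) = Erases-apps (eapp D (Erases-refl _ u)) us

castE : ∀ {d M M' N N'} → M ≡ M' → N ≡ N' → Erases d M N → Erases d M' N'
castE refl refl D = D

FreeRen : ℕ → ℕ → (ℕ → ℕ) → Set
FreeRen d e ρ = ∀ j → d ≤ j → e ≤ ρ j

ext-FreeRen : ∀ {d e ρ} → FreeRen d e ρ → FreeRen (suc d) (suc e) (ext ρ)
ext-FreeRen ok zero    ()
ext-FreeRen ok (suc j) (s≤s d≤j) = s≤s (ok j d≤j)

suc-FreeRen : ∀ {d} → FreeRen d (suc d) suc
suc-FreeRen j d≤j = s≤s d≤j

swap-FreeRen : ∀ {d} → FreeRen (suc (suc d)) (suc (suc d)) swap01
swap-FreeRen zero          ()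
swap-FreeRen (suc zero)    (s≤s ())
swap-FreeRen (suc (suc j)) d≤j = d≤j

inst : ℕ → ℕ → ℕ
inst i zero    = i
inst i (suc j) = j

inst-FreeRen : ∀ {d} i → FreeRen (suc d) d (inst i)
inst-FreeRen i zero    ()
inst-FreeRen i (suc j) (s≤s d≤j) = d≤j

rename-inst : ∀ i X → rename (inst i) X ≡ X [ var i ]
rename-inst i X =
  trans (rename-as-sub (inst i) X) (trans (sub-cong agree X) (sym ([]-as-sub X (var i))))
  where
  agree : ∀ j → var (inst i j) ≡ single (var i) j
  agree zero    = refl
  agree (suc j) = refl

Erases-rename : ∀ {d e ρ M N} → FreeRen d e ρ → Erases d M N → Erases e (rename ρ M) (rename ρ N)
Erases-rename ok evar       = evar
Erases-rename ok (elam D)   = elam (Erases-rename (ext-FreeRen ok) D)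
Erases-rename ok (eapp D E) = eapp (Erases-rename ok D) (Erases-rename ok E)
Erases-rename {ρ = ρ} ok (emark {B = B} {i = i} d≤i D refl) =
  emark (ok _ d≤i) (Erases-rename (ext-FreeRen ok) D) (rename-[] ρ B i)

record ErasingSub (e e' : ℕ) (σ τ : ℕ → Term) : Set where
  field
    related  : ∀ j → Erases e' (σ j) (τ j)
    freeVars : ∀ j → e ≤ j → Σ ℕ λ k → e' ≤ k × σ j ≡ var k × τ j ≡ var k
open ErasingSub

exts-ErasingSub : ∀ {e e' σ τ} → ErasingSub e e' σ τ →
                  ErasingSub (suc e) (suc e') (exts σ) (exts τ)
exts-ErasingSub ok .related zero    = evar
exts-ErasingSub ok .related (suc j) = Erases-rename suc-FreeRen (related ok j)
exts-ErasingSub ok .freeVars zero    ()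
exts-ErasingSub ok .freeVars (suc j) (s≤s e≤j) with freeVars ok j e≤j
... | k , e'≤k , σj≡k , τj≡k = suc k , s≤s e'≤k , cong shift σj≡k , cong shift τj≡k

single-ErasingSub : ∀ {d N Q} → Erases d N Q → ErasingSub (suc d) d (single N) (single Q)
single-ErasingSub DN .related zero    = DN
single-ErasingSub DN .related (suc j) = evar
single-ErasingSub DN .freeVars zero    ()
single-ErasingSub DN .freeVars (suc j) (s≤s d≤j) = j , d≤j , refl , refl

Erases-sub : ∀ {e e' σ τ M N} → ErasingSub e e' σ τ → Erases e M N → Erases e' (sub σ M) (sub τ N)
Erases-sub ok (evar {i = i}) = related ok i
Erases-sub ok (elam D)       = elam (Erases-sub (exts-ErasingSub ok) D)
Erases-sub ok (eapp D E)     = eapp (Erases-sub ok D) (Erases-sub ok E)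
Erases-sub {σ = σ} {τ} ok (emark {A = A} {B} {i} e≤i D refl) with freeVars ok i e≤i
... | k , e'≤k , σi≡k , τi≡k =
  castE (cong (app (lam (sub (exts σ) A))) (sym σi≡k)) refl
    (emark e'≤k (Erases-sub (exts-ErasingSub ok) D)
      (trans (sub-[] τ B (var i)) (cong (sub (exts τ) B [_]) τi≡k)))

-- 3. The weight of an erasure derivation

-- marks   : number of marked redexes
-- size    : number of variable occurrences and applications
-- cost    : charges every mark for the applications it can still be pulled
--           out of by γ or assoc, plus a fixed price for firing it
-- depth   : for every mark, the number of binders inside its body
--           (δ pushes a mark under a binder and decreases it)
-- binders : number of binders (λ and marks)
record Weight : Set where
  constructor weight
  field
    marks size cost depth binders : ℕ
open Weight

wVar : Weight
wVar = weight 0 1 0 0 0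

wLam : Weight → Weight
wLam (weight n s c l b) = weight n s c l (suc b)

wApp : Weight → Weight → Weight
wApp (weight n₁ s₁ c₁ l₁ b₁) (weight n₂ s₂ c₂ l₂ b₂) =
  weight (n₁ + n₂) (suc (s₁ + s₂)) (c₁ + c₂ + n₂ * s₁ + n₁ * s₂ + n₁ + n₂) (l₁ + l₂) (b₁ + b₂)

wMark : Weight → Weight
wMark (weight n s c l b) = weight (suc n) (suc (suc s)) (c + 2 * suc n) (l + b) (suc b)

weightOf : ∀ {d M N} → Erases d M N → Weight
weightOf evar          = wVar
weightOf (elam D)      = wLam (weightOf D)
weightOf (eapp D E)    = wApp (weightOf D) (weightOf E)
weightOf (emark _ D _) = wMark (weightOf D)

weightOf-castE : ∀ {d M M' N N'} (p : M ≡ M') (q : N ≡ N') (D : Erases d M N) →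
                 weightOf (castE p q D) ≡ weightOf D
weightOf-castE refl refl D = refl

weightOf-rename : ∀ {d e ρ M N} (ok : FreeRen d e ρ) (D : Erases d M N) →
                  weightOf (Erases-rename ok D) ≡ weightOf D
weightOf-rename ok evar             = refl
weightOf-rename ok (elam D)         = cong wLam (weightOf-rename (ext-FreeRen ok) D)
weightOf-rename ok (eapp D E)       = cong₂ wApp (weightOf-rename ok D) (weightOf-rename ok E)
weightOf-rename ok (emark _ D refl) = cong wMark (weightOf-rename (ext-FreeRen ok) D)

-- a ≻ b: the weight decreases, in a way preserved by every term former:
-- either the cost drops (marks and size not increasing), or everything but
-- the depth is unchanged and the depth drops.
data _≻_ : Weight → Weight → Set where
  cost↓  : ∀ {a b} → cost b < cost a → marks b ≤ marks a → size b ≤ size a → a ≻ b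
  depth↓ : ∀ {a b} → marks b ≡ marks a → size b ≡ size a → cost b ≡ cost a →
           binders b ≡ binders a → depth b < depth a → a ≻ b

≻-lam : ∀ {a b} → a ≻ b → wLam a ≻ wLam b
≻-lam {weight _ _ _ _ _} {weight _ _ _ _ _} (cost↓ c< n≤ s≤) = cost↓ c< n≤ s≤
≻-lam {weight _ _ _ _ _} {weight _ _ _ _ _} (depth↓ refl refl refl refl l<) =
  depth↓ refl refl refl refl l<

≻-mark : ∀ {a b} → a ≻ b → wMark a ≻ wMark b
≻-mark {weight n s c l b} {weight n' s' c' l' b'} (cost↓ c< n≤ s≤) =
  cost↓ (+-mono-<-≤ c< (*-monoʳ-≤ 2 (s≤s n≤))) (s≤s n≤) (s≤s (s≤s s≤))
≻-mark {weight n s c l b} {weight _ _ _ l' _} (depth↓ refl refl refl refl l<) =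
  depth↓ refl refl refl refl (+-monoˡ-< b l<)

≻-appˡ : ∀ {a b w} → a ≻ b → wApp a w ≻ wApp b w
≻-appˡ {weight n₁ s₁ c₁ l₁ b₁} {weight n₁' s₁' c₁' l₁' b₁'} {weight n₂ s₂ c₂ l₂ b₂}
       (cost↓ c< n≤ s≤) =
  cost↓ (+-mono-<-≤ (+-mono-<-≤ (+-mono-<-≤ (+-mono-<-≤ (+-monoˡ-< c₂ c<)
                       (*-monoʳ-≤ n₂ s≤)) (*-monoˡ-≤ s₂ n≤)) n≤) (≤-refl {n₂}))
        (+-monoˡ-≤ n₂ n≤) (s≤s (+-monoˡ-≤ s₂ s≤))
≻-appˡ {weight _ _ _ _ _} {weight _ _ _ l₁' _} {weight _ _ _ l₂ _}
       (depth↓ refl refl refl refl l<) =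
  depth↓ refl refl refl refl (+-monoˡ-< l₂ l<)

≻-appʳ : ∀ {a b w} → a ≻ b → wApp w a ≻ wApp w b
≻-appʳ {weight n₂ s₂ c₂ l₂ b₂} {weight n₂' s₂' c₂' l₂' b₂'} {weight n₁ s₁ c₁ l₁ b₁}
       (cost↓ c< n≤ s≤) =
  cost↓ (+-mono-<-≤ (+-mono-<-≤ (+-mono-<-≤ (+-mono-<-≤ (+-monoʳ-< c₁ c<)
                       (*-monoˡ-≤ s₁ n≤)) (*-monoʳ-≤ n₁ s≤)) (≤-refl {n₁})) n≤)
        (+-monoʳ-≤ n₁ n≤) (s≤s (+-monoʳ-≤ s₁ s≤))
≻-appʳ {weight _ _ _ _ _} {weight _ _ _ l₂' _} {weight _ _ _ l₁ _}
       (depth↓ refl refl refl refl l<) =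
  depth↓ refl refl refl refl (+-monoʳ-< l₁ l<)

≻-fire : ∀ a → wMark a ≻ a
≻-fire (weight n s c l b) = cost↓ (m<m+n c (s≤s z≤n)) (n≤1+n n) (m≤n+m s 2)

≻-δ : ∀ a → wMark (wLam a) ≻ wLam (wMark a)
≻-δ (weight n s c l b) = depth↓ refl refl refl refl (+-monoʳ-< l (n<1+n b))

<-of-≡ : ∀ {x y} k → x ≡ suc k + y → y < x
<-of-≡ {x} {y} k x≡ = subst (y <_) (sym x≡) (s≤s (m≤n+m y k))

γ-cost : ∀ n s c n' s' c' →
  (c + 2 * suc n) + c' + n' * suc (suc s) + suc n * s' + suc n + n'
    ≡ suc s' + ((c + c' + n' * s + n * s' + n + n') + 2 * suc (n + n'))
γ-cost = solve-∀

assoc-cost : ∀ n s c n' s' c' →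
  c + (c' + 2 * suc n') + suc n' * s + n * suc (suc s') + n + suc n'
    ≡ suc s + ((c + c' + n' * s + n * s' + n + n') + 2 * suc (n + n'))
assoc-cost = solve-∀

≻-γ : ∀ a w → wApp (wMark a) w ≻ wMark (wApp a w)
≻-γ (weight n s c l b) (weight n' s' c' l' b') =
  cost↓ (<-of-≡ s' (γ-cost n s c n' s' c')) ≤-refl ≤-refl

≻-assoc : ∀ w a → wApp w (wMark a) ≻ wMark (wApp w a)
≻-assoc (weight n s c l b) (weight n' s' c' l' b') =
  cost↓ (<-of-≡ s (assoc-cost n s c n' s' c')) (≤-reflexive (sym (+-suc n n')))
        (≤-reflexive (cong suc (trans (cong suc (sym (+-suc s s'))) (sym (+-suc s (suc s'))))))

_<ₗₑₓ_ : ℕ × ℕ → ℕ × ℕ → Set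
_<ₗₑₓ_ = ×-Lex _≡_ _<_ _<_

rank : Weight → ℕ × ℕ
rank a = cost a , depth a

≻⇒<ₗₑₓ : ∀ {a b} → a ≻ b → rank b <ₗₑₓ rank a
≻⇒<ₗₑₓ (cost↓ c< _ _)         = inj₁ c<
≻⇒<ₗₑₓ (depth↓ _ _ c≡ _ l<)   = inj₂ (c≡ , l<)

-- 4. Simulation

data Step {d M N} (D : Erases d M N) (M' : Term) : Set where
  matched : ∀ {N'} → N ▷ N' → Erases d M' N' → Step D M'
  silent  : (D' : Erases d M' N) → weightOf D ≻ weightOf D' → Step D M'

lam-injective : ∀ {M N} → lam M ≡ lam N → M ≡ N
lam-injective refl = refl

lam-[] : ∀ C i → (lam C) [ var i ] ≡ lam ((rename swap01 C) [ var (suc i) ])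
lam-[] C i = trans ([]-as-sub (lam C) (var i))
  (cong lam (trans (sub-cong agree C) (sym (trans ([]-as-sub (rename swap01 C) (var (suc i)))
     (sub-rename (single (var (suc i))) swap01 C)))))
  where
  agree : ∀ j → exts (single (var i)) j ≡ single (var (suc i)) (swap01 j)
  agree zero          = refl
  agree (suc zero)    = refl
  agree (suc (suc k)) = refl

fire-silent : ∀ {d A B i} (d≤i : d ≤ i) (DA : Erases (suc d) A B) →
              Step (emark d≤i DA refl) (A [ var i ])
fire-silent {A = A} {B} {i} _ DA =
  silent (castE (rename-inst i A) (rename-inst i B) (Erases-rename (inst-FreeRen i) DA))
    (subst (wMark (weightOf DA) ≻_)
      (sym (trans (weightOf-castE _ _ _) (weightOf-rename (inst-FreeRen i) DA)))
      (≻-fire (weightOf DA)))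

δ-silent : ∀ {d A C i} (d≤i : d ≤ i) (DB : Erases (suc (suc d)) A C) →
           Step (emark d≤i (elam DB) refl)
                (lam (app (lam (rename swap01 A)) (shift (var i))))
δ-silent {C = C} {i} d≤i DB =
  silent (elam (emark (s≤s d≤i) (Erases-rename swap-FreeRen DB) (lam-injective (lam-[] C i))))
    (subst (λ w → wMark (wLam (weightOf DB)) ≻ wLam (wMark w))
      (sym (weightOf-rename swap-FreeRen DB)) (≻-δ (weightOf DB)))

γ-silent : ∀ {d A B i P Q} (d≤i : d ≤ i) (DA : Erases (suc d) A B) (DP : Erases d P Q) →
           Step (eapp (emark d≤i DA refl) DP) (app (lam (app A (shift P))) (var i))
γ-silent {B = B} {i} {Q = Q} d≤i DA DP =
  silent (emark d≤i (eapp DA (Erases-rename suc-FreeRen DP))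
                    (cong (app (B [ var i ])) (sym (shift-[] Q (var i)))))
    (subst (λ w → wApp (wMark (weightOf DA)) (weightOf DP) ≻ wMark (wApp (weightOf DA) w))
      (sym (weightOf-rename suc-FreeRen DP)) (≻-γ (weightOf DA) (weightOf DP)))

assoc-silent : ∀ {d M₀ M₁ A B i} (DM : Erases d M₀ M₁) (d≤i : d ≤ i) (DA : Erases (suc d) A B) →
               Step (eapp DM (emark d≤i DA refl)) (app (lam (app (shift M₀) A)) (var i))
assoc-silent {M₁ = M₁} {B = B} {i} DM d≤i DA =
  silent (emark d≤i (eapp (Erases-rename suc-FreeRen DM) DA)
                    (cong (λ M₁' → app M₁' (B [ var i ])) (sym (shift-[] M₁ (var i)))))
    (subst (λ w → wApp (weightOf DM) (wMark (weightOf DA)) ≻ wMark (wApp w (weightOf DA)))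
      (sym (weightOf-rename suc-FreeRen DM)) (≻-assoc (weightOf DM) (weightOf DA)))

simulate : ∀ {d M N M'} (D : Erases d M N) → M ▷ M' → Step D M'
simulate (eapp {P = N₁} {Q = Q} (elam {M = A} {N = B} DA) DN) β =
  matched β (castE (sym ([]-as-sub A N₁)) (sym ([]-as-sub B Q))
                   (Erases-sub (single-ErasingSub DN) DA))
simulate (eapp (elam (elam DB)) DN) δ =
  matched δ (elam (eapp (elam (Erases-rename swap-FreeRen DB)) (Erases-rename suc-FreeRen DN)))
simulate (eapp (eapp (elam DA) DN) DP) γ =
  matched γ (eapp (elam (eapp DA (Erases-rename suc-FreeRen DP))) DN)
simulate (eapp DM (eapp (elam DA) DP)) assoc =
  matched assoc (eapp (elam (eapp (Erases-rename suc-FreeRen DM) DA)) DP)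
simulate (emark d≤i DA refl) β = fire-silent d≤i DA
simulate (emark d≤i (elam DB) refl) δ = δ-silent d≤i DB
simulate (eapp (emark d≤i DA refl) DP) γ = γ-silent d≤i DA DP
simulate (eapp DM (emark d≤i DA refl)) assoc = assoc-silent DM d≤i DA
simulate (elam D) (ξlam s) with simulate D s
... | matched s' D' = matched (ξlam s') (elam D')
... | silent D' D≻D' = silent (elam D') (≻-lam D≻D')
simulate (eapp D E) (ξappl s) with simulate D s
... | matched s' D' = matched (ξappl s') (eapp D' E)
... | silent D' D≻D' = silent (eapp D' E) (≻-appˡ D≻D')
simulate (eapp D E) (ξappr s) with simulate E s
... | matched s' E' = matched (ξappr s') (eapp D E')
... | silent E' E≻E' = silent (eapp D E') (≻-appʳ E≻E')
simulate (emark d≤i DA refl) (ξappl (ξlam s)) with simulate DA s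
... | matched s' DA' = matched (▷-[] _ s') (emark d≤i DA' refl)
... | silent DA' DA≻DA' = silent (emark d≤i DA' refl) (≻-mark DA≻DA')
simulate (emark _ _ refl) (ξappr ())

-- 5. Strong normalization is reflected by erasure

rank-wf : ∀ {d M N} (D : Erases d M N) → Acc _<ₗₑₓ_ (rank (weightOf D))
rank-wf D = ×-wellFounded <-wellFounded <-wellFounded (rank (weightOf D))

-- Induction on SN N and, for a fixed N, on the rank of the derivation:
-- matched steps decrease N, silent steps keep N and decrease the rank.
mutual
  reflect : ∀ {d M N} (D : Erases d M N) → SN N → Acc _<ₗₑₓ_ (rank (weightOf D)) → SN M
  reflect D snN accD = acc λ s → reflect-step D snN accD (simulate D s)

  reflect-step : ∀ {d M N M'} (D : Erases d M N) → SN N → Acc _<ₗₑₓ_ (rank (weightOf D)) →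
                 Step D M' → SN M'
  reflect-step D (acc snN) _ (matched s' D') = reflect D' (snN s') (rank-wf D')
  reflect-step D snN (acc smaller) (silent D' D≻D') = reflect D' snN (smaller (≻⇒<ₗₑₓ D≻D'))

Erases-SN : ∀ {d M N} (D : Erases d M N) → SN N → SN M
Erases-SN D snN = reflect D snN (rank-wf D)

-- The theorem: (λx.t) x u₁ … uₖ erases to t u₁ … uₖ by firing the single
-- marked redex (λx.t) x.
lemma3p3 : (𝒜 : Set) (t : Term) (us : List Term) (x : ℕ)
    → (∀ {u} → u ∈ us → ¬ Free x u)
    → SystemD.Typable 𝒜 (apps t us)
    → SN (apps t us)
    → SN (apps (app (ƛ x t) (var x)) us)
lemma3p3 𝒜 t us x _ _ sn = Erases-SN (Erases-apps marked us) sn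
  where
  marked : Erases 0 (app (ƛ x t) (var x)) t
  marked = emark z≤n (Erases-refl 1 (close x t)) (sym (close-[] x t))
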